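{- Let $\eta$ be a prefix and $P,Q,Q'$ microCCS processes. If $\eta.P\sim Q|Q'$ with $Q\not\sim\mathbf 0$ and $Q'\not\sim\mathbf 0$, then there exist a process $A$ and an integer $k>1$ such that $\eta.P\sim(\eta.A)^k$ and $\eta.A$ is a normal form with respect to $\rightarrow_d$.
   Context: MicroCCS processes: $\eta ::= a \mid \overline{a}$ (names $a$), $P ::= \mathbf{0} \mid \eta.P \mid P|Q$. Structural congruence $\equiv$: smallest congruence with $P|Q\equiv Q|P$, $P|(Q|R)\equiv(P|Q)|R$, $P|\mathbf 0\equiv P$. Transitions: $\eta.P\xrightarrow{\eta}P$; if $P\xrightarrow{\eta}P'$, $Q\xrightarrow{\overline\eta}Q'$ then $P|Q\xrightarrow{\tau}P'|Q'$; if $P\xrightarrow{\mu}P'$ then $P|Q\xrightarrow{\mu}P'|Q$ and $Q|P\xrightarrow{\mu}Q|P'$. Strong bisimilarity $\sim$ is the union of all symmetric relations $\mathcal R$ such that $P\mathcal RQ$, $P\xrightarrow{\mu}P'$ imply $Q\xrightarrow{\mu}Q'$ with $P'\mathcal RQ'$. $R^k$ is the $k$-fold parallel composition of $R$. $P\rightarrow_d P'$ holds when there are $P_1,P_2$ with $P\equiv P_1$, $P_2\equiv P'$ and $P_2$ obtained from $P_1$ by replacing a subterm $\eta.(R|(\eta.R)^k)$, $k\geq1$, by $(\eta.R)^{k+1}$. A normal form is a process $A$ with no $A'$ such that $A\rightarrow_d A'$. -}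

module Defs where

open import Data.Nat using (ℕ; zero; suc; _≤_)
open import Data.Product using (Σ; ∃; _×_; _,_)
open import Relation.Nullary using (¬_)

Name : Set
Name = ℕ

data Prefix : Set where
  inp : Name → Prefix
  out : Name → Prefix

co : Prefix → Prefix
co (inp a) = out a
co (out a) = inp a

data Proc : Set where
  𝟎   : Proc
  _∙_ : Prefix → Proc → Proc
  _∣_ : Proc → Proc → Proc

infixr 6 _∙_
infixl 5 _∣_

data _≡ₛ_ : Proc → Proc → Set where
  sc-refl  : ∀ {P} → P ≡ₛ P
  sc-sym   : ∀ {P Q} → P ≡ₛ Q → Q ≡ₛ P
  sc-trans : ∀ {P Q R} → P ≡ₛ Q → Q ≡ₛ R → P ≡ₛ R
  sc-pre   : ∀ {η P Q} → P ≡ₛ Q → (η ∙ P) ≡ₛ (η ∙ Q)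
  sc-par   : ∀ {P P' Q Q'} → P ≡ₛ P' → Q ≡ₛ Q' → (P ∣ Q) ≡ₛ (P' ∣ Q')
  sc-comm  : ∀ {P Q} → (P ∣ Q) ≡ₛ (Q ∣ P)
  sc-assoc : ∀ {P Q R} → (P ∣ (Q ∣ R)) ≡ₛ ((P ∣ Q) ∣ R)
  sc-unit  : ∀ {P} → (P ∣ 𝟎) ≡ₛ P

data Label : Set where
  act : Prefix → Label
  τ   : Label

data _─[_]→_ : Proc → Label → Proc → Set where
  t-pre  : ∀ {η P} → (η ∙ P) ─[ act η ]→ P
  t-sync : ∀ {η P P' Q Q'} → P ─[ act η ]→ P' → Q ─[ act (co η) ]→ Q' →
           (P ∣ Q) ─[ τ ]→ (P' ∣ Q')
  t-parL : ∀ {μ P P' Q} → P ─[ μ ]→ P' → (P ∣ Q) ─[ μ ]→ (P' ∣ Q)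
  t-parR : ∀ {μ P P' Q} → P ─[ μ ]→ P' → (Q ∣ P) ─[ μ ]→ (Q ∣ P')

record IsBisim (ℛ : Proc → Proc → Set) : Set where
  field
    symm  : ∀ {P Q} → ℛ P Q → ℛ Q P
    match : ∀ {P Q μ P'} → ℛ P Q → P ─[ μ ]→ P' →
            Σ Proc (λ Q' → (Q ─[ μ ]→ Q') × ℛ P' Q')

_∼_ : Proc → Proc → Set₁
P ∼ Q = Σ (Proc → Proc → Set) (λ ℛ → IsBisim ℛ × ℛ P Q)

-- k-fold parallel composition R^k (meaningful for k ≥ 1; R^0 = 0 by convention)
_^_ : Proc → ℕ → Proc
R ^ zero = 𝟎
R ^ suc zero = R
R ^ suc (suc k) = R ∣ (R ^ suc k)

data Rep : Proc → Proc → Set where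
  rep-here : ∀ {η R k} → 1 ≤ k →
             Rep (η ∙ (R ∣ ((η ∙ R) ^ k))) ((η ∙ R) ^ suc k)
  rep-pre  : ∀ {η P P'} → Rep P P' → Rep (η ∙ P) (η ∙ P')
  rep-parL : ∀ {P P' Q} → Rep P P' → Rep (P ∣ Q) (P' ∣ Q)
  rep-parR : ∀ {P P' Q} → Rep P P' → Rep (Q ∣ P) (Q ∣ P')

_→d_ : Proc → Proc → Set
P →d P' = Σ Proc (λ P₁ → Σ Proc (λ P₂ → (P ≡ₛ P₁) × Rep P₁ P₂ × (P₂ ≡ₛ P')))

NormalForm : Proc → Set
NormalForm A = ¬ (Σ Proc (λ A' → A →d A'))

-- A finite process has finitely many reachable states and its bisimilarity approximants
-- stabilise beyond its size, so bisimilarity and primality are decidable, and every process is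
-- constructively bisimilar to a parallel composition of prime prefixed processes η.B whose
-- continuations B are decomposed in the same way. By induction on size, this decomposition is
-- unique up to bisimilarity (Milner and Moller).
--
-- If η.P ∼ Q ∣ Q' with Q, Q' nontrivial, the decomposition of Q ∣ Q' has k ≥ 2 components.
-- Every move of η.P leads to P, so firing any two components leaves residues with the same
-- decomposition, which forces every component to be bisimilar to a deepest one, η.A. Hence
-- η.P ∼ (η.A)^k, and η.A is a normal form because its prefixed subterms are prime while a
-- →d redex η.(R ∣ (η.R)^k) is bisimilar to η.R ∣ (η.R)^k.
module Submission where

open import Defs
open import Data.Empty using (⊥-elim)
open import Data.List using (List; []; _∷_; _++_; length)
open import Data.List.Extrema.Nat using (argmax; argmax-sel; f[⊥]≤f[argmax]; f[xs]≤f[argmax])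
open import Data.List.Membership.Propositional using (_∈_)
open import Data.List.Membership.Propositional.Properties using (∈-++⁻)
open import Data.List.Properties using (length-++)
open import Data.List.Relation.Unary.All using (All; []; _∷_)
import Data.List.Relation.Unary.All as All
import Data.List.Relation.Unary.All.Properties as All
open import Data.List.Relation.Unary.Any using (here; there; _─_)
open import Data.Nat using (ℕ; zero; suc; _+_; _≤_; _<_; z≤n; s≤s; s≤s⁻¹; _≟_; _<?_)
open import Data.Nat.Induction using (<-wellFounded)
open import Data.Nat.Properties
  using (≤-refl; ≤-trans; <-trans; ≤-<-trans; <-≤-trans; ≤-reflexive; ≤-antisym; <-irrefl; n≮0; 1+n≢n;
         suc-injective; m≤m+n; m≤n+m; m<m+n; m<n+m; +-suc; +-assoc; +-cancelˡ-≡;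
         +-mono-≤; +-monoˡ-≤; +-mono-<; +-monoˡ-<; +-monoʳ-<; +-commutativeSemigroup; module ≤-Reasoning)
open import Algebra.Properties.CommutativeSemigroup +-commutativeSemigroup using (x∙yz≈y∙xz)
open import Data.Product using (Σ; ∃; ∃₂; _×_; _,_; proj₁; proj₂)
open import Data.Sum using (_⊎_; inj₁; inj₂; [_,_]′)
open import Data.Unit using (⊤; tt)
open import Function using (case_of_; _∘_)
open import Induction.WellFounded using (Acc; acc)
open import Relation.Binary.PropositionalEquality
  using (_≡_; _≢_; refl; sym; trans; cong; cong₂; subst; module ≡-Reasoning)
open import Relation.Nullary using (¬_; Dec; yes; no; contradiction)
open import Relation.Nullary.Decidable using (map′; _×-dec_; _⊎-dec_; ¬?; decidable-stable)

variable
  η : Prefix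
  μ : Label
  n : ℕ
  B C P Q R W X X' Y Y' Z : Proc

prefix-≟ : (η η' : Prefix) → Dec (η ≡ η')
prefix-≟ (inp a) (inp b) = map′ (cong inp) (λ { refl → refl }) (a ≟ b)
prefix-≟ (out a) (out b) = map′ (cong out) (λ { refl → refl }) (a ≟ b)
prefix-≟ (inp a) (out b) = no λ ()
prefix-≟ (out a) (inp b) = no λ ()

label-≟ : (μ ν : Label) → Dec (μ ≡ ν)
label-≟ (act η) (act η') = map′ (cong act) (λ { refl → refl }) (prefix-≟ η η')
label-≟ (act η) τ = no λ ()
label-≟ τ (act η) = no λ ()
label-≟ τ τ = yes refl

co-involutive : ∀ η → co (co η) ≡ η
co-involutive (inp a) = refl
co-involutive (out a) = refl

co-irreflexive : ∀ η → co η ≢ η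
co-irreflexive (inp a) ()
co-irreflexive (out a) ()

size : Proc → ℕ
size 𝟎 = 0
size (η ∙ P) = suc (size P)
size (P ∣ Q) = size P + size Q

Nontrivial : Proc → Set
Nontrivial X = 0 < size X

trivial-or-nontrivial : ∀ X → size X ≡ 0 ⊎ Nontrivial X
trivial-or-nontrivial X with size X
... | zero = inj₁ refl
... | suc _ = inj₂ (s≤s z≤n)

size-step : X ─[ μ ]→ X' → size X' < size X
size-step t-pre = ≤-refl
size-step (t-sync t u) = +-mono-< (size-step t) (size-step u)
size-step (t-parL {Q = Q} t) = +-monoˡ-< (size Q) (size-step t)
size-step (t-parR {Q = Q} t) = +-monoʳ-< (size Q) (size-step t)

step-size-pred : ∀ X → Nontrivial X → ∃₂ λ μ X' → X ─[ μ ]→ X' × size X ≡ suc (size X')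
step-size-pred (η ∙ P) _ = act η , P , t-pre , refl
step-size-pred (P ∣ Q) nt with trivial-or-nontrivial P
... | inj₂ ntP = let (μ , P' , t , e) = step-size-pred P ntP in μ , P' ∣ Q , t-parL t , cong (_+ size Q) e
... | inj₁ zP =
  let (μ , Q' , t , e) = step-size-pred Q (subst (λ m → 0 < m + size Q) zP nt)
  in μ , P ∣ Q' , t-parR t , trans (cong (size P +_) e) (+-suc (size P) (size Q'))

AnyStep : Proc → (Label → Proc → Set) → Set
AnyStep X R = ∃₂ λ μ X' → X ─[ μ ]→ X' × R μ X'

AllSteps : Proc → (Label → Proc → Set) → Set
AllSteps X R = ∀ {μ X'} → X ─[ μ ]→ X' → R μ X'

anyStep? : ∀ X {R} → (∀ μ X' → Dec (R μ X')) → Dec (AnyStep X R)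
anyStep? 𝟎 R? = no λ { (_ , _ , () , _) }
anyStep? (η ∙ P) R? = map′ (λ r → act η , P , t-pre , r) (λ { (_ , _ , t-pre , r) → r }) (R? (act η) P)
anyStep? (P ∣ Q) {R} R? =
  map′ [ left , [ right , sync ]′ ]′ cases
       (anyStep? P (λ μ P' → R? μ (P' ∣ Q)) ⊎-dec
         (anyStep? Q (λ μ Q' → R? μ (P ∣ Q')) ⊎-dec anyStep? P partner?))
  where
  Partner : Label → Proc → Set
  Partner μ P' = ∃ λ η → μ ≡ act η × AnyStep Q (λ ν Q' → ν ≡ act (co η) × R τ (P' ∣ Q'))

  partner? : ∀ μ P' → Dec (Partner μ P')
  partner? τ P' = no λ { (_ , () , _) }
  partner? (act η) P' =
    map′ (λ s → η , refl , s) (λ { (_ , refl , s) → s })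
         (anyStep? Q (λ ν Q' → label-≟ ν (act (co η)) ×-dec R? τ (P' ∣ Q')))

  left : AnyStep P (λ μ P' → R μ (P' ∣ Q)) → AnyStep (P ∣ Q) R
  left (μ , P' , t , r) = μ , P' ∣ Q , t-parL t , r

  right : AnyStep Q (λ μ Q' → R μ (P ∣ Q')) → AnyStep (P ∣ Q) R
  right (μ , Q' , t , r) = μ , P ∣ Q' , t-parR t , r

  sync : AnyStep P Partner → AnyStep (P ∣ Q) R
  sync (_ , P' , t , _ , refl , _ , Q' , u , refl , r) = τ , P' ∣ Q' , t-sync t u , r

  cases : AnyStep (P ∣ Q) R →
          AnyStep P (λ μ P' → R μ (P' ∣ Q)) ⊎ (AnyStep Q (λ μ Q' → R μ (P ∣ Q')) ⊎ AnyStep P Partner)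
  cases (μ , _ , t-parL t , r) = inj₁ (μ , _ , t , r)
  cases (μ , _ , t-parR t , r) = inj₂ (inj₁ (μ , _ , t , r))
  cases (τ , _ , t-sync {η} t u , r) = inj₂ (inj₂ (act η , _ , t , η , refl , _ , _ , u , refl , r))

allSteps? : ∀ X {R} → (∀ μ X' → Dec (R μ X')) → Dec (AllSteps X R)
allSteps? X R? =
  map′ (λ none t → decidable-stable (R? _ _) λ ¬r → none (_ , _ , t , ¬r))
       (λ all → λ { (_ , _ , t , ¬r) → ¬r (all t) })
       (¬? (anyStep? X (λ μ X' → ¬? (R? μ X'))))

Step : Proc → Label → (Proc → Set) → Set
Step X μ S = ∃ λ X' → X ─[ μ ]→ X' × S X'

step? : ∀ X μ {S} → (∀ X' → Dec (S X')) → Dec (Step X μ S)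
step? X μ S? =
  map′ (λ { (_ , X' , t , refl , s) → X' , t , s }) (λ (X' , t , s) → μ , X' , t , refl , s)
       (anyStep? X (λ ν X' → label-≟ ν μ ×-dec S? X'))

-- Stratified bisimilarity

infix 4 _≈[_]_ _≲[_]_ _≃_

mutual
  _≈[_]_ : Proc → ℕ → Proc → Set
  X ≈[ zero ] Y = ⊤
  X ≈[ suc n ] Y = X ≲[ n ] Y × Y ≲[ n ] X

  _≲[_]_ : Proc → ℕ → Proc → Set
  X ≲[ n ] Y = AllSteps X (λ μ X' → Step Y μ (X' ≈[ n ]_))

≈-refl : ∀ n → X ≈[ n ] X
≈-refl zero = tt
≈-refl (suc n) = (λ t → _ , t , ≈-refl n) , (λ t → _ , t , ≈-refl n)

≈-sym : ∀ n → X ≈[ n ] Y → Y ≈[ n ] X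
≈-sym zero _ = tt
≈-sym (suc n) (f , g) = g , f

mutual
  ≈-trans : ∀ n → X ≈[ n ] Y → Y ≈[ n ] Z → X ≈[ n ] Z
  ≈-trans zero _ _ = tt
  ≈-trans (suc n) (f , g) (f' , g') = ≲-trans n f f' , ≲-trans n g' g

  ≲-trans : ∀ n → X ≲[ n ] Y → Y ≲[ n ] Z → X ≲[ n ] Z
  ≲-trans n f f' t =
    let (_ , u , r) = f t ; (Z' , v , r') = f' u in Z' , v , ≈-trans n r r'

≈? : ∀ n X Y → Dec (X ≈[ n ] Y)
≈? zero X Y = yes tt
≈? (suc n) X Y = ≲? X Y ×-dec ≲? Y X
  where
  ≲? : ∀ X Y → Dec (X ≲[ n ] Y)
  ≲? X Y = allSteps? X (λ μ X' → step? Y μ (≈? n X'))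

-- Used instead of ∼, with which it coincides (≃⇒∼, ∼⇒≃), because it is decidable.
_≃_ : Proc → Proc → Set
X ≃ Y = ∀ n → X ≈[ n ] Y

≃-refl : X ≃ X
≃-refl n = ≈-refl n

≃-sym : X ≃ Y → Y ≃ X
≃-sym h n = ≈-sym n (h n)

≃-trans : X ≃ Y → Y ≃ Z → X ≃ Z
≃-trans h h' n = ≈-trans n (h n) (h' n)

-- Runs of X have length at most size X, so deeper approximants add no information.
≈-stable : size X < n → size Y < n → X ≈[ n ] Y → X ≃ Y
≈-stable _ _ _ zero = tt
≈-stable {n = suc n} sX sY (f , g) (suc m) =
  (λ t → let (Y' , u , r) = f t in Y' , u , ≈-stable (below t sX) (below u sY) r m) ,
  (λ u → let (X' , t , r) = g u in X' , t , ≈-stable (below u sY) (below t sX) r m)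
  where
  below : X ─[ μ ]→ X' → size X < suc n → size X' < n
  below t lt = <-≤-trans (size-step t) (s≤s⁻¹ lt)

private
  bound : Proc → Proc → ℕ
  bound X Y = suc (size X + size Y)

  size<boundˡ : ∀ X Y → size X < bound X Y
  size<boundˡ X Y = s≤s (m≤m+n (size X) (size Y))

  size<boundʳ : ∀ X Y → size Y < bound X Y
  size<boundʳ X Y = s≤s (m≤n+m (size Y) (size X))

≃? : ∀ X Y → Dec (X ≃ Y)
≃? X Y = map′ (≈-stable (size<boundˡ X Y) (size<boundʳ X Y)) (λ h → h (bound X Y)) (≈? (bound X Y) X Y)

≃-match : X ≃ Y → X ─[ μ ]→ X' → Step Y μ (X' ≃_)
≃-match {X} {Y} h t =
  let (Y' , u , r) = proj₁ (h (suc (bound X Y))) t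
  in Y' , u , ≈-stable (<-trans (size-step t) (size<boundˡ X Y)) (<-trans (size-step u) (size<boundʳ X Y)) r

≃⇒∼ : X ≃ Y → X ∼ Y
≃⇒∼ h = _≃_ , record { symm = ≃-sym ; match = ≃-match } , h

∼⇒≃ : X ∼ Y → X ≃ Y
∼⇒≃ (ℛ , bisim , r) = approximate r
  where
  open IsBisim bisim
  approximate : ℛ X Y → X ≃ Y
  approximate r zero = tt
  approximate r (suc n) =
    (λ t → let (Y' , u , r') = match r t in Y' , u , approximate r' n) ,
    (λ u → let (X' , t , r') = match (symm r) u in X' , t , approximate r' n)

≈-pred : ∀ n → X ≈[ suc n ] Y → X ≈[ n ] Y
≈-pred zero _ = tt
≈-pred (suc n) (f , g) = weaken f , weaken g
  where
  weaken : X ≲[ suc n ] Y → X ≲[ n ] Y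
  weaken f t = let (Y' , u , r) = f t in Y' , u , ≈-pred n r

≈-par : ∀ n → X ≈[ n ] X' → Y ≈[ n ] Y' → X ∣ Y ≈[ n ] X' ∣ Y'
≈-par zero _ _ = tt
≈-par (suc n) hX hY = sim hX hY , sim (≈-sym (suc n) hX) (≈-sym (suc n) hY)
  where
  sim : X ≈[ suc n ] X' → Y ≈[ suc n ] Y' → X ∣ Y ≲[ n ] X' ∣ Y'
  sim (f , _) hY (t-parL t) = let (_ , t' , r) = f t in _ , t-parL t' , ≈-par n r (≈-pred n hY)
  sim hX (f , _) (t-parR t) = let (_ , t' , r) = f t in _ , t-parR t' , ≈-par n (≈-pred n hX) r
  sim (f , _) (f' , _) (t-sync t u) =
    let (_ , t' , r) = f t ; (_ , u' , r') = f' u in _ , t-sync t' u' , ≈-par n r r'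

≃-par : X ≃ X' → Y ≃ Y' → X ∣ Y ≃ X' ∣ Y'
≃-par hX hY n = ≈-par n (hX n) (hY n)

≃-pre : ∀ η → X ≃ Y → η ∙ X ≃ η ∙ Y
≃-pre η h zero = tt
≃-pre η h (suc n) = (λ { t-pre → _ , t-pre , h n }) , (λ { t-pre → _ , t-pre , ≈-sym n (h n) })

≈-comm : ∀ n → X ∣ Y ≈[ n ] Y ∣ X
≈-comm zero = tt
≈-comm (suc n) = swap , swap
  where
  swap : X ∣ Y ≲[ n ] Y ∣ X
  swap (t-parL t) = _ , t-parR t , ≈-comm n
  swap (t-parR t) = _ , t-parL t , ≈-comm n
  swap (t-sync {η = η} t u) =
    _ , t-sync u (subst (λ ν → _ ─[ act ν ]→ _) (sym (co-involutive η)) t) , ≈-comm n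

≈-assoc : ∀ n → X ∣ (Y ∣ Z) ≈[ n ] (X ∣ Y) ∣ Z
≈-assoc zero = tt
≈-assoc (suc n) = right-to-left , left-to-right
  where
  right-to-left : X ∣ (Y ∣ Z) ≲[ n ] (X ∣ Y) ∣ Z
  right-to-left (t-parL t) = _ , t-parL (t-parL t) , ≈-assoc n
  right-to-left (t-parR (t-parL t)) = _ , t-parL (t-parR t) , ≈-assoc n
  right-to-left (t-parR (t-parR t)) = _ , t-parR t , ≈-assoc n
  right-to-left (t-parR (t-sync t u)) = _ , t-sync (t-parR t) u , ≈-assoc n
  right-to-left (t-sync t (t-parL u)) = _ , t-parL (t-sync t u) , ≈-assoc n
  right-to-left (t-sync t (t-parR u)) = _ , t-sync (t-parL t) u , ≈-assoc n

  left-to-right : (X ∣ Y) ∣ Z ≲[ n ] X ∣ (Y ∣ Z)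
  left-to-right (t-parL (t-parL t)) = _ , t-parL t , ≈-sym n (≈-assoc n)
  left-to-right (t-parL (t-parR t)) = _ , t-parR (t-parL t) , ≈-sym n (≈-assoc n)
  left-to-right (t-parL (t-sync t u)) = _ , t-sync t (t-parL u) , ≈-sym n (≈-assoc n)
  left-to-right (t-parR t) = _ , t-parR (t-parR t) , ≈-sym n (≈-assoc n)
  left-to-right (t-sync (t-parL t) u) = _ , t-sync t (t-parR u) , ≈-sym n (≈-assoc n)
  left-to-right (t-sync (t-parR t) u) = _ , t-parR (t-sync t u) , ≈-sym n (≈-assoc n)

≈-unit : ∀ n → X ∣ 𝟎 ≈[ n ] X
≈-unit zero = tt
≈-unit (suc n) = (λ { (t-parL t) → _ , t , ≈-unit n ; (t-parR ()) ; (t-sync _ ()) }) ,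
                 (λ t → _ , t-parL t , ≈-sym n (≈-unit n))

≃-comm : X ∣ Y ≃ Y ∣ X
≃-comm n = ≈-comm n

≃-assoc : X ∣ (Y ∣ Z) ≃ (X ∣ Y) ∣ Z
≃-assoc n = ≈-assoc n

≃-unitʳ : X ∣ 𝟎 ≃ X
≃-unitʳ n = ≈-unit n

≃-unitˡ : 𝟎 ∣ X ≃ X
≃-unitˡ = ≃-trans ≃-comm ≃-unitʳ

≃-swap : X ∣ (Y ∣ Z) ≃ Y ∣ (X ∣ Z)
≃-swap = ≃-trans ≃-assoc (≃-trans (≃-par ≃-comm ≃-refl) (≃-sym ≃-assoc))

≡ₛ⇒≃ : X ≡ₛ Y → X ≃ Y
≡ₛ⇒≃ sc-refl = ≃-refl
≡ₛ⇒≃ (sc-sym e) = ≃-sym (≡ₛ⇒≃ e)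
≡ₛ⇒≃ (sc-trans e e') = ≃-trans (≡ₛ⇒≃ e) (≡ₛ⇒≃ e')
≡ₛ⇒≃ (sc-pre {η = η} e) = ≃-pre η (≡ₛ⇒≃ e)
≡ₛ⇒≃ (sc-par e e') = ≃-par (≡ₛ⇒≃ e) (≡ₛ⇒≃ e')
≡ₛ⇒≃ sc-comm = ≃-comm
≡ₛ⇒≃ sc-assoc = ≃-assoc
≡ₛ⇒≃ sc-unit = ≃-unitʳ

-- size X is the length of the longest run of X, and ≈[ n ] matches runs of length n.
≈-size : ∀ n → X ≈[ n ] Y → n ≤ size X → n ≤ size Y
≈-size zero _ _ = z≤n
≈-size {X} (suc n) (f , _) le =
  let (_ , _ , t , e) = step-size-pred X (≤-trans (s≤s z≤n) le)
      (_ , u , r) = f t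
  in ≤-trans (s≤s (≈-size n r (s≤s⁻¹ (subst (suc n ≤_) e le)))) (size-step u)

≃-size : X ≃ Y → size X ≡ size Y
≃-size {X} {Y} h = ≤-antisym (≈-size (size X) (h (size X)) ≤-refl) (≈-size (size Y) (≃-sym h (size Y)) ≤-refl)

trivial : size X ≡ 0 → X ≃ 𝟎
trivial z zero = tt
trivial z (suc n) = (λ t → ⊥-elim (n≮0 (subst (_ <_) z (size-step t)))) , λ ()

nontrivial-≃ : X ≃ Y → Nontrivial X → Nontrivial Y
nontrivial-≃ h nt = subst (0 <_) (≃-size h) nt

≃-prefix-elim : X ≃ η ∙ P → X ─[ μ ]→ X' → μ ≡ act η × X' ≃ P
≃-prefix-elim h t with ≃-match h t
... | _ , t-pre , r = refl , r

≃-prefix-intro : Step Y (act η) (_≃ P) → AllSteps Y (λ μ Y' → μ ≡ act η × Y' ≃ P) → η ∙ P ≃ Y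
≃-prefix-intro _ _ zero = tt
≃-prefix-intro {Y} {η} {P} (Y₀ , t₀ , h₀) all (suc n) =
  (λ { t-pre → Y₀ , t₀ , ≈-sym n (h₀ n) }) , (λ t → prefix-move (all t))
  where
  prefix-move : μ ≡ act η × Y' ≃ P → Step (η ∙ P) μ (Y' ≈[ n ]_)
  prefix-move (refl , h) = P , t-pre , h n

≃-prefix-injective : η ∙ P ≃ η ∙ Q → P ≃ Q
≃-prefix-injective h = proj₂ (≃-prefix-elim h t-pre)

^-suc : ∀ m → X ∣ X ^ m ≃ X ^ suc m
^-suc zero = ≃-unitʳ
^-suc (suc m) = ≃-refl

act-injective : ∀ {η η'} → act η ≡ act η' → η ≡ η'
act-injective refl = refl

power-steps : ∀ m → AllSteps ((η ∙ R) ^ suc m) (λ μ W → μ ≡ act η × W ≃ R ∣ (η ∙ R) ^ m)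
power-steps zero t-pre = refl , ≃-sym ≃-unitʳ
power-steps (suc m) (t-parL t-pre) = refl , ≃-refl
power-steps (suc m) (t-parR t) =
  let (e , h) = power-steps m t
  in e , ≃-trans (≃-par ≃-refl h) (≃-trans ≃-swap (≃-par ≃-refl (^-suc m)))
power-steps {η} (suc m) (t-sync t-pre u) =
  ⊥-elim (co-irreflexive η (act-injective (proj₁ (power-steps m u))))

redex-≃ : ∀ k → η ∙ (R ∣ (η ∙ R) ^ suc k) ≃ (η ∙ R) ^ suc (suc k)
redex-≃ k = ≃-prefix-intro (_ , t-parL t-pre , ≃-refl) (power-steps (suc k))

-- Primality

data Reach : ℕ → Proc → Proc → Set where
  done : Reach n X X
  move : X ─[ μ ]→ X' → Reach n X' Y → Reach (suc n) X Y

reach? : ∀ n X {S : Proc → Set} → (∀ Y → Dec (S Y)) → Dec (∃ λ Y → Reach n X Y × S Y)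
reach? zero X S? = map′ (λ s → X , done , s) (λ { (_ , done , s) → s }) (S? X)
reach? (suc n) X {S} S? =
  map′ [ (λ s → X , done , s) , (λ { (_ , _ , t , Y , r , s) → Y , move t r , s }) ]′ cases
       (S? X ⊎-dec anyStep? X (λ _ X' → reach? n X' S?))
  where
  cases : ∃ (λ Y → Reach (suc n) X Y × S Y) → S X ⊎ AnyStep X (λ _ X' → ∃ λ Y → Reach n X' Y × S Y)
  cases (_ , done , s) = inj₁ s
  cases (Y , move t r , s) = inj₂ (_ , _ , t , Y , r , s)

reach-weaken : ∀ {m} → m ≤ n → Reach m X Y → Reach n X Y
reach-weaken _ done = done
reach-weaken (s≤s le) (move t r) = move t (reach-weaken le r)

reach-parʳ : Reach n Y Y' → Reach n (X ∣ Y) (X ∣ Y')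
reach-parʳ done = done
reach-parʳ (move t r) = move (t-parR t) (reach-parʳ r)

reach-≃ : X ≃ Y → Reach n Y Y' → ∃ λ X' → Reach n X X' × X' ≃ Y'
reach-≃ h done = _ , done , h
reach-≃ h (move u r) =
  let (_ , t , h₁) = ≃-match (≃-sym h) u ; (X' , r' , h') = reach-≃ (≃-sym h₁) r
  in X' , move t r' , h'

drain : ∀ n X → size X ≡ n → ∃ λ X₀ → Reach n X X₀ × size X₀ ≡ 0
drain zero X z = X , done , z
drain (suc n) X e =
  let (_ , X' , t , e') = step-size-pred X (subst (0 <_) (sym e) (s≤s z≤n))
      (X₀ , r , z) = drain n X' (suc-injective (trans (sym e') e))
  in X₀ , move t r , z

Split : Proc → Set
Split X = ∃₂ λ Y Z → Nontrivial Y × Nontrivial Z × X ≃ Y ∣ Z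

Prime : Proc → Set
Prime X = Nontrivial X × ¬ Split X

split-≃ : X ≃ X' → Split X → Split X'
split-≃ h (Y , Z , nY , nZ , h') = Y , Z , nY , nZ , ≃-trans (≃-sym h) h'

prime-≃ : X ≃ X' → Prime X → Prime X'
prime-≃ h (nt , ¬split) = nontrivial-≃ h nt , λ s → ¬split (split-≃ (≃-sym h) s)

-- Run Z down to an inert process inside Y ∣ Z and follow that run in X.
factor-reachable : X ≃ Y ∣ Z → ∃ λ Y' → Reach (size X) X Y' × Y' ≃ Y
factor-reachable {X} {Y} {Z} h =
  let (_ , r , z) = drain (size Z) Z refl
      (Y' , r' , h') = reach-≃ h (reach-parʳ {X = Y} r)
  in Y' , reach-weaken (subst (size Z ≤_) (sym (≃-size h)) (m≤n+m (size Z) (size Y))) r' ,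
     ≃-trans h' (≃-trans (≃-par ≃-refl (trivial z)) ≃-unitʳ)

split? : ∀ X → Dec (Split X)
split? X =
  map′ (λ { (Y , _ , Z , _ , nY , nZ , h) → Y , Z , nY , nZ , h }) reachable-split
       (reach? (size X) X λ Y → reach? (size X) X λ Z →
          (0 <? size Y) ×-dec (0 <? size Z) ×-dec ≃? X (Y ∣ Z))
  where
  reachable-split : Split X → ∃ λ Y → Reach (size X) X Y × ∃ λ Z → Reach (size X) X Z ×
                      Nontrivial Y × Nontrivial Z × X ≃ Y ∣ Z
  reachable-split (Y , Z , nY , nZ , h) =
    let (Y' , rY , hY) = factor-reachable h
        (Z' , rZ , hZ) = factor-reachable (≃-trans h ≃-comm)
    in Y' , rY , Z' , rZ , nontrivial-≃ (≃-sym hY) nY , nontrivial-≃ (≃-sym hZ) nZ ,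
       ≃-trans h (≃-par (≃-sym hY) (≃-sym hZ))

PrimeSubterms : Proc → Set
PrimeSubterms 𝟎 = ⊤
PrimeSubterms (η ∙ P) = Prime (η ∙ P) × PrimeSubterms P
PrimeSubterms (P ∣ Q) = PrimeSubterms P × PrimeSubterms Q

primeSubterms-≡ₛ : X ≡ₛ Y → (PrimeSubterms X → PrimeSubterms Y) × (PrimeSubterms Y → PrimeSubterms X)
primeSubterms-≡ₛ sc-refl = (λ s → s) , (λ s → s)
primeSubterms-≡ₛ (sc-sym e) = let (to , from) = primeSubterms-≡ₛ e in from , to
primeSubterms-≡ₛ (sc-trans e e') =
  let (to , from) = primeSubterms-≡ₛ e ; (to' , from') = primeSubterms-≡ₛ e'
  in (λ s → to' (to s)) , (λ s → from (from' s))
primeSubterms-≡ₛ (sc-pre e) =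
  let (to , from) = primeSubterms-≡ₛ e ; h = ≡ₛ⇒≃ (sc-pre e)
  in (λ (p , s) → prime-≃ h p , to s) , (λ (p , s) → prime-≃ (≃-sym h) p , from s)
primeSubterms-≡ₛ (sc-par e e') =
  let (to , from) = primeSubterms-≡ₛ e ; (to' , from') = primeSubterms-≡ₛ e'
  in (λ (s , s') → to s , to' s') , (λ (s , s') → from s , from' s')
primeSubterms-≡ₛ sc-comm = (λ (s , s') → s' , s) , (λ (s , s') → s' , s)
primeSubterms-≡ₛ sc-assoc = (λ (s , s' , s'') → (s , s') , s'') , (λ ((s , s') , s'') → s , s' , s'')
primeSubterms-≡ₛ sc-unit = proj₁ , (λ s → s , tt)

rep-¬primeSubterms : Rep X Y → ¬ PrimeSubterms X
rep-¬primeSubterms (rep-here {k = suc k} _) ((_ , ¬split) , _) =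
  ¬split (_ , _ , s≤s z≤n , ^-nontrivial k , redex-≃ k)
  where
  ^-nontrivial : ∀ k → Nontrivial ((η ∙ R) ^ suc k)
  ^-nontrivial zero = s≤s z≤n
  ^-nontrivial (suc k) = s≤s z≤n
rep-¬primeSubterms (rep-pre r) (_ , s) = rep-¬primeSubterms r s
rep-¬primeSubterms (rep-parL r) (s , _) = rep-¬primeSubterms r s
rep-¬primeSubterms (rep-parR r) (_ , s) = rep-¬primeSubterms r s

primeSubterms⇒normalForm : PrimeSubterms X → NormalForm X
primeSubterms⇒normalForm s (_ , _ , _ , e , r , _) = rep-¬primeSubterms r (proj₁ (primeSubterms-≡ₛ e) s)

prime-prefixed : ∀ X → Prime X → ∃₂ λ η B → X ≃ η ∙ B
prime-prefixed 𝟎 (() , _)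
prime-prefixed (η ∙ B) _ = η , B , ≃-refl
prime-prefixed (Y ∣ Z) p@(_ , ¬split) with trivial-or-nontrivial Y | trivial-or-nontrivial Z
... | inj₂ nY | inj₂ nZ = ⊥-elim (¬split (Y , Z , nY , nZ , ≃-refl))
... | inj₁ zY | _ =
  let Y∣Z≃Z = ≃-trans (≃-par (trivial zY) ≃-refl) ≃-unitˡ
      (η , B , h) = prime-prefixed Z (prime-≃ Y∣Z≃Z p)
  in η , B , ≃-trans Y∣Z≃Z h
... | inj₂ _ | inj₁ zZ =
  let Y∣Z≃Y = ≃-trans (≃-par ≃-refl (trivial zZ)) ≃-unitʳ
      (η , B , h) = prime-prefixed Y (prime-≃ Y∣Z≃Y p)
  in η , B , ≃-trans Y∣Z≃Y h

-- Prime decomposition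

Prefixed : Set
Prefixed = Prefix × Proc

proc : Prefixed → Proc
proc (η , P) = η ∙ P

variable
  t u : Prefixed
  L M : List Prefixed

par : List Prefixed → Proc
par [] = 𝟎
par (t ∷ L) = proc t ∣ par L

par-++ : ∀ L M → par (L ++ M) ≃ par L ∣ par M
par-++ [] M = ≃-sym ≃-unitˡ
par-++ (t ∷ L) M = ≃-trans (≃-par ≃-refl (par-++ L M)) ≃-assoc

par-─ : (p : t ∈ L) → par L ≃ proc t ∣ par (L ─ p)
par-─ (here refl) = ≃-refl
par-─ (there p) = ≃-trans (≃-par ≃-refl (par-─ p)) ≃-swap

fire : (p : (η , B) ∈ L) → Step (par L) (act η) (_≃ B ∣ par (L ─ p))
fire (here refl) = _ , t-parL t-pre , ≃-refl
fire (there {x = u} p) =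
  let (W , t , h) = fire p in proc u ∣ W , t-parR t , ≃-trans (≃-par ≃-refl h) ≃-swap

fired : ∀ L → par L ─[ act η ]→ W → ∃ λ C → Σ ((η , C) ∈ L) λ q → W ≃ C ∣ par (L ─ q)
fired ((η , C) ∷ L) (t-parL t-pre) = C , here refl , ≃-refl
fired (u ∷ L) (t-parR t) =
  let (C , q , h) = fired L t in C , there q , ≃-trans (≃-par ≃-refl h) ≃-swap

nonempty : Nontrivial (par L) → ∃ (_∈ L)
nonempty {t ∷ L} _ = t , here refl

indicator : ∀ {A : Set} → Dec A → ℕ
indicator (yes _) = 1
indicator (no _) = 0

hit : Proc → Prefixed → ℕ
hit σ t = indicator (≃? (proc t) σ)

count : Proc → List Prefixed → ℕ
count σ [] = 0
count σ (t ∷ L) = hit σ t + count σ L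

indicator-yes : ∀ {A : Set} (a? : Dec A) → A → indicator a? ≡ 1
indicator-yes (yes _) _ = refl
indicator-yes (no ¬a) a = contradiction a ¬a

indicator-no : ∀ {A : Set} (a? : Dec A) → ¬ A → indicator a? ≡ 0
indicator-no (yes a) ¬a = contradiction a ¬a
indicator-no (no _) _ = refl

indicator≤1 : ∀ {A : Set} (a? : Dec A) → indicator a? ≤ 1
indicator≤1 (yes _) = ≤-refl
indicator≤1 (no _) = z≤n

hit-≃ : ∀ {σ} → proc t ≃ σ → hit σ t ≡ 1
hit-≃ {t} {σ} = indicator-yes (≃? (proc t) σ)

hit-≄ : ∀ {σ} → ¬ proc t ≃ σ → hit σ t ≡ 0
hit-≄ {t} {σ} = indicator-no (≃? (proc t) σ)

hit≤1 : ∀ σ t → hit σ t ≤ 1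
hit≤1 σ t = indicator≤1 (≃? (proc t) σ)

hit-cong : ∀ σ → proc t ≃ proc u → hit σ t ≡ hit σ u
hit-cong {t} {u} σ h = case ≃? (proc u) σ of λ where
  (yes h') → trans (hit-≃ {t} (≃-trans h h')) (sym (hit-≃ {u} h'))
  (no ¬h') → trans (hit-≄ {t} λ h'' → ¬h' (≃-trans (≃-sym h) h'')) (sym (hit-≄ {u} ¬h'))

count-++ : ∀ σ L M → count σ (L ++ M) ≡ count σ L + count σ M
count-++ σ [] M = refl
count-++ σ (t ∷ L) M = trans (cong (hit σ t +_) (count-++ σ L M)) (sym (+-assoc (hit σ t) _ _))

count-─ : ∀ σ (p : t ∈ L) → count σ L ≡ hit σ t + count σ (L ─ p)
count-─ σ (here refl) = refl
count-─ {t} σ (there {x = u} p) =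
  trans (cong (hit σ u +_) (count-─ σ p)) (x∙yz≈y∙xz (hit σ u) (hit σ t) _)

count-─-≤ : ∀ σ (p : t ∈ L) → count σ (L ─ p) ≤ count σ L
count-─-≤ {t} {L} σ p = subst (count σ (L ─ p) ≤_) (sym (count-─ σ p)) (m≤n+m _ (hit σ t))

count-shallow : ∀ σ L → size (par L) < size σ → count σ L ≡ 0
count-shallow σ [] _ = refl
count-shallow σ (t ∷ L) lt =
  cong₂ _+_ (hit-≄ λ h → <-irrefl (≃-size h) (≤-<-trans (m≤m+n _ _) lt))
            (count-shallow σ L (≤-<-trans (m≤n+m _ _) lt))

count-nonzero : ∀ σ L → 0 < count σ L → ∃ λ t → t ∈ L × proc t ≃ σ
count-nonzero σ (t ∷ L) pos = case ≃? (proc t) σ of λ where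
  (yes h) → t , here refl , h
  (no ¬h) →
    let (u , u∈L , h) = count-nonzero σ L (subst (λ m → 0 < m + count σ L) (hit-≄ {t} ¬h) pos)
    in u , there u∈L , h

Primes : List Prefixed → Set
Primes = All (Prime ∘ proc)

Decomposition : Proc → Set
Decomposition X = ∃ λ D → All (PrimeSubterms ∘ proc) D × par D ≃ X

primeSubterms-par : All (PrimeSubterms ∘ proc) L → PrimeSubterms (par L)
primeSubterms-par [] = tt
primeSubterms-par (s ∷ ss) = s , primeSubterms-par ss

decomposition : ∀ X → Decomposition X
decomposition X = decompose X (<-wellFounded (size X))
  where
  decompose : ∀ X → Acc _<_ (size X) → Decomposition X
  decompose X (acc smaller) with trivial-or-nontrivial X
  ... | inj₁ z = [] , [] , ≃-sym (trivial z)
  ... | inj₂ nt with split? X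
  ...   | yes (Y , Z , nY , nZ , h) =
    let e = ≃-size h
        (DY , sY , hY) = decompose Y (smaller (subst (size Y <_) (sym e) (m<m+n (size Y) nZ)))
        (DZ , sZ , hZ) = decompose Z (smaller (subst (size Z <_) (sym e) (m<n+m (size Z) nY)))
    in DY ++ DZ , All.++⁺ sY sZ , ≃-trans (par-++ DY DZ) (≃-trans (≃-par hY hZ) (≃-sym h))
  ...   | no ¬split =
    let (η , B , h) = prime-prefixed X (nt , ¬split)
        (DB , sB , hB) = decompose B (smaller (subst (size B <_) (sym (≃-size h)) ≤-refl))
    in (η , par DB) ∷ [] ,
       (prime-≃ (≃-trans h (≃-pre η (≃-sym hB))) (nt , ¬split) , primeSubterms-par sB) ∷ [] ,
       ≃-trans ≃-unitʳ (≃-trans (≃-pre η hB) (≃-sym h))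

primes : Proc → List Prefixed
primes X = proj₁ (decomposition X)

primes-primeSubterms : ∀ X → All (PrimeSubterms ∘ proc) (primes X)
primes-primeSubterms X = proj₁ (proj₂ (decomposition X))

primes-prime : ∀ X → Primes (primes X)
primes-prime X = All.map proj₁ (primes-primeSubterms X)

par-primes : ∀ X → par (primes X) ≃ X
par-primes X = proj₂ (proj₂ (decomposition X))

count-primes-shallow : ∀ σ → size X < size σ → count σ (primes X) ≡ 0
count-primes-shallow {X} σ lt = count-shallow σ (primes X) (subst (_< size σ) (sym (≃-size (par-primes X))) lt)

-- Uniqueness of prime decomposition

SameCounts : List Prefixed → List Prefixed → Set
SameCounts L M = ∀ σ → count σ L ≡ count σ M

UniqueBelow : ℕ → Set
UniqueBelow n = ∀ {L M} → Primes L → Primes M → par L ≃ par M → size (par L) < n → SameCounts L M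

par-primes-++ : ∀ X K → par (primes X ++ K) ≃ X ∣ par K
par-primes-++ X K = ≃-trans (par-++ (primes X) K) (≃-par (par-primes X) ≃-refl)

-- The residues of a matched move are smaller than par L, so the induction hypothesis applies.
residue : UniqueBelow n → Primes L → Primes M → par L ≃ par M → size (par L) ≤ n →
          (p : (η , B) ∈ L) → ∃ λ C → Σ ((η , C) ∈ M) λ q →
          SameCounts (primes B ++ (L ─ p)) (primes C ++ (M ─ q))
residue {L = L} {M} {B = B} unique pL pM h le p =
  let (_ , t , hW) = fire p
      (_ , t' , hWW') = ≃-match h t
      (C , q , hW') = fired M t'
      refinedL = ≃-trans (par-primes-++ B (L ─ p)) (≃-sym hW)
  in C , q ,
     unique (All.++⁺ (primes-prime B) (All.─⁺ p pL)) (All.++⁺ (primes-prime C) (All.─⁺ q pM))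
            (≃-trans refinedL (≃-trans hWW' (≃-trans hW' (≃-sym (par-primes-++ C (M ─ q))))))
            (<-≤-trans (subst (_< size (par L)) (sym (≃-size refinedL)) (size-step t)) le)

count-residue : ∀ σ B C {K K'} → size B < size σ → size C < size σ →
                SameCounts (primes B ++ K) (primes C ++ K') → count σ K ≡ count σ K'
count-residue σ B C {K} {K'} ltB ltC same = let open ≡-Reasoning in begin
  count σ K                         ≡⟨ cong (_+ count σ K) (count-primes-shallow {B} σ ltB) ⟨
  count σ (primes B) + count σ K    ≡⟨ count-++ σ (primes B) K ⟨
  count σ (primes B ++ K)           ≡⟨ same σ ⟩
  count σ (primes C ++ K')          ≡⟨ count-++ σ (primes C) K' ⟩
  count σ (primes C) + count σ K'   ≡⟨ cong (_+ count σ K') (count-primes-shallow {C} σ ltC) ⟩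
  count σ K'                        ∎

cancel-primes : ∀ B C {K K'} → SameCounts (primes B) (primes C) →
                SameCounts (primes B ++ K) (primes C ++ K') → SameCounts K K'
cancel-primes B C {K} {K'} same same' σ =
  let open ≡-Reasoning in +-cancelˡ-≡ (count σ (primes B)) _ _ (begin
  count σ (primes B) + count σ K    ≡⟨ count-++ σ (primes B) K ⟨
  count σ (primes B ++ K)           ≡⟨ same' σ ⟩
  count σ (primes C ++ K')          ≡⟨ count-++ σ (primes C) K' ⟩
  count σ (primes C) + count σ K'   ≡⟨ cong (_+ count σ K') (same σ) ⟨
  count σ (primes B) + count σ K'   ∎)

prime-occurs : Prime X → X ≃ par M → 0 < count X M
prime-occurs {M = []} (nt , _) h = contradiction (≃-size h) λ e → <-irrefl (sym e) nt
prime-occurs {X} {ρ ∷ M} (_ , ¬split) h with trivial-or-nontrivial (par M)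
... | inj₁ z = subst (λ m → 0 < m + count X M) (sym (hit-≃ {ρ} (≃-sym ρ≃X))) (s≤s z≤n)
  where
  ρ≃X : X ≃ proc ρ
  ρ≃X = ≃-trans h (≃-trans (≃-par ≃-refl (trivial z)) ≃-unitʳ)
... | inj₂ nt = ⊥-elim (¬split (proc ρ , par M , s≤s z≤n , nt , h))

Deepest : Prefixed → List Prefixed → Set
Deepest s L = All (λ t → size (proc t) ≤ size (proc s)) L

-- σ = η.B has maximal size among the components of both sides. If the move of σ is answered
-- by an equivalent component, cancel them. Otherwise σ occurs once more in the left list than
-- in M; but σ does occur in M (by primality, or by firing a second component on the left), and
-- answering a σ-move of M gives the reverse inequality.
module DeepestComponent {n η B L M} (unique : UniqueBelow n)
  (pL : Primes ((η , B) ∷ L)) (pM : Primes M) (h : par ((η , B) ∷ L) ≃ par M)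
  (le : size (par ((η , B) ∷ L)) ≤ n)
  (deepL : Deepest (η , B) ((η , B) ∷ L)) (deepM : Deepest (η , B) M) where

  σ : Proc
  σ = η ∙ B

  count-σ : ∀ K → count σ ((η , B) ∷ K) ≡ suc (count σ K)
  count-σ K = cong (_+ count σ K) (hit-≃ {η , B} ≃-refl)

  unmatched : (q : (η , C) ∈ M) → ¬ η ∙ C ≃ σ →
              SameCounts (primes B ++ L) (primes C ++ (M ─ q)) → count σ ((η , B) ∷ L) ≡ suc (count σ M)
  unmatched {C} q ≄ same = let open ≡-Reasoning in begin
    count σ ((η , B) ∷ L)                  ≡⟨ count-σ L ⟩
    suc (count σ L)                        ≡⟨ cong suc (count-residue σ B C ≤-refl (All.lookup deepM q) same) ⟩
    suc (count σ (M ─ q))                  ≡⟨ cong (λ m → suc (m + count σ (M ─ q))) (hit-≄ {η , C} ≄) ⟨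
    suc (hit σ (η , C) + count σ (M ─ q))  ≡⟨ cong suc (count-─ σ q) ⟨
    suc (count σ M)                        ∎

  present⇒bounded : 0 < count σ M → count σ ((η , B) ∷ L) ≤ count σ M
  present⇒bounded pos =
    let ((η' , B') , q , μ≃σ) = count-nonzero σ M pos
        (C , p , same) = residue unique pM pL (≃-sym h) (subst (_≤ n) (≃-size h) le) q
        eq = count-residue σ B' C (≤-reflexive (≃-size μ≃σ)) (All.lookup deepL p) same
        open ≤-Reasoning
    in begin
      count σ ((η , B) ∷ L)                         ≡⟨ count-─ σ p ⟩
      hit σ (η' , C) + count σ (((η , B) ∷ L) ─ p)  ≤⟨ +-monoˡ-≤ _ (hit≤1 σ (η' , C)) ⟩
      suc (count σ (((η , B) ∷ L) ─ p))             ≡⟨ cong suc eq ⟨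
      suc (count σ (M ─ q))                         ≡⟨ cong (_+ count σ (M ─ q)) (hit-≃ {η' , B'} μ≃σ) ⟨
      hit σ (η' , B') + count σ (M ─ q)             ≡⟨ count-─ σ q ⟨
      count σ M                                     ∎

  second-component⇒present : ∀ {κ} → κ ∈ L → 0 < count σ M
  second-component⇒present {κ} p =
    let (C , q , same) = residue unique pL pM h le (there p)
        eq = count-residue σ (proj₂ κ) C (All.lookup deepL (there p)) (All.lookup deepM q) same
        open ≤-Reasoning
    in begin-strict
      0                                <⟨ s≤s z≤n ⟩
      suc (count σ (L ─ p))            ≡⟨ count-σ (L ─ p) ⟨
      count σ ((η , B) ∷ (L ─ p))      ≡⟨ eq ⟩
      count σ (M ─ q)                  ≤⟨ count-─-≤ σ q ⟩
      count σ M                        ∎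

  present : 0 < count σ M
  present with trivial-or-nontrivial (par L)
  ... | inj₁ z = prime-occurs (All.head pL) (≃-trans (≃-trans (≃-sym ≃-unitʳ) (≃-par ≃-refl (≃-sym (trivial z)))) h)
  ... | inj₂ nt = second-component⇒present (proj₂ (nonempty nt))

  matched : (q : (η , C) ∈ M) → η ∙ C ≃ σ →
            SameCounts (primes B ++ L) (primes C ++ (M ─ q)) → SameCounts ((η , B) ∷ L) M
  matched {C} q ρ≃σ same σ' = begin
    hit σ' (η , B) + count σ' L        ≡⟨ cong₂ _+_ (hit-cong σ' (≃-sym ρ≃σ)) (cancel-primes B C sameBC same σ') ⟩
    hit σ' (η , C) + count σ' (M ─ q)  ≡⟨ count-─ σ' q ⟨
    count σ' M                         ∎
    where
    open ≡-Reasoning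
    sameBC : SameCounts (primes B) (primes C)
    sameBC = unique (primes-prime B) (primes-prime C)
                    (≃-trans (par-primes B) (≃-trans (≃-prefix-injective (≃-sym ρ≃σ)) (≃-sym (par-primes C))))
                    (subst (λ m → suc m ≤ n) (sym (≃-size (par-primes B))) (≤-trans (m≤m+n (suc (size B)) _) le))

  sameCounts : SameCounts ((η , B) ∷ L) M
  sameCounts =
    let (C , q , same) = residue unique pL pM h le (here refl)
    in case ≃? (η ∙ C) σ of λ where
      (yes ρ≃σ) → matched q ρ≃σ same
      (no ρ≄σ) → ⊥-elim (<-irrefl refl (subst (_≤ count σ M) (unmatched q ρ≄σ same) (present⇒bounded present)))

deepest : ∀ t L → ∃ λ s → s ∈ t ∷ L × Deepest s (t ∷ L)
deepest t L =
  argmax (size ∘ proc) t L , [ here , there ]′ (argmax-sel (size ∘ proc) t L) ,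
  f[⊥]≤f[argmax] {f = size ∘ proc} t L ∷ f[xs]≤f[argmax] {f = size ∘ proc} t L

sameCounts-deepest : UniqueBelow n → Primes L → Primes M → par L ≃ par M → size (par L) ≤ n →
                     ∀ {s} → s ∈ L → Deepest s L → Deepest s M → SameCounts L M
sameCounts-deepest {n} {L} {M} unique pL pM h le p deepL deepM σ =
  trans (count-─ σ p)
        (DeepestComponent.sameCounts unique (All.lookup pL p ∷ All.─⁺ p pL) pM (≃-trans (≃-sym (par-─ p)) h)
                                     (subst (_≤ n) (≃-size (par-─ p)) le)
                                     (All.lookup deepL p ∷ All.─⁺ p deepL) deepM σ)

uniqueBelow : ∀ n → UniqueBelow n
uniqueBelow zero _ _ _ ()
uniqueBelow (suc n) {[]} {[]} _ _ _ _ σ = refl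
uniqueBelow (suc n) {[]} {t ∷ M} _ _ h _ = case ≃-size h of λ ()
uniqueBelow (suc n) {t ∷ L} {M} pL pM h lt with deepest t (L ++ M)
... | s , s∈ , deep with ∈-++⁻ (t ∷ L) s∈ | All.++⁻ (t ∷ L) deep
...   | inj₁ p | deepL , deepM = sameCounts-deepest (uniqueBelow n) pL pM h (s≤s⁻¹ lt) p deepL deepM
...   | inj₂ q | deepL , deepM = λ σ →
  sym (sameCounts-deepest (uniqueBelow n) pM pL (≃-sym h) (subst (_≤ n) (≃-size h) (s≤s⁻¹ lt)) q deepM deepL σ)

uniqueness : Primes L → Primes M → par L ≃ par M → SameCounts L M
uniqueness {L} pL pM h = uniqueBelow (suc (size (par L))) pL pM h ≤-refl

par-all-≃ : (∀ {r} → r ∈ L → proc r ≃ X) → par L ≃ X ^ length L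
par-all-≃ {[]} _ = ≃-refl
par-all-≃ {t ∷ L} all = ≃-trans (≃-par (all (here refl)) (par-all-≃ (all ∘ there))) (^-suc (length L))

prefix-components-≃ : Primes L → par L ≃ η ∙ P → ∀ {s r} → (p : s ∈ L) → Deepest s L → r ∈ L →
                      proc r ≃ proc s
prefix-components-≃ {L} {η} {P} pL h {s = ηs , Bs} {r = ηr , Br} p deep q =
  case ≃? (ηr ∙ Br) σ of λ where
    (yes r≃s) → r≃s
    (no r≄s) → ⊥-elim (1+n≢n (begin
      suc (count σ (L ─ p))              ≡⟨ cong (_+ count σ (L ─ p)) (hit-≃ {ηs , Bs} ≃-refl) ⟨
      hit σ (ηs , Bs) + count σ (L ─ p)  ≡⟨ count-─ σ p ⟨
      count σ L                          ≡⟨ count-─ σ q ⟩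
      hit σ (ηr , Br) + count σ (L ─ q)  ≡⟨ cong (_+ count σ (L ─ q)) (hit-≄ {ηr , Br} r≄s) ⟩
      count σ (L ─ q)                    ≡⟨ count-residue σ Br Bs (All.lookup deep q) ≤-refl (sym ∘ same) ⟩
      count σ (L ─ p)                    ∎))
  where
  open ≡-Reasoning
  σ : Proc
  σ = ηs ∙ Bs

  residue-≃ : ∀ {η' B'} (p : (η' , B') ∈ L) → par (primes B' ++ (L ─ p)) ≃ P
  residue-≃ p = let (_ , t , hW) = fire p in
    ≃-trans (par-primes-++ _ (L ─ p)) (≃-trans (≃-sym hW) (proj₂ (≃-prefix-elim h t)))

  same : SameCounts (primes Bs ++ (L ─ p)) (primes Br ++ (L ─ q))
  same = uniqueness (All.++⁺ (primes-prime Bs) (All.─⁺ p pL)) (All.++⁺ (primes-prime Br) (All.─⁺ q pL))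
                    (≃-trans (residue-≃ p) (≃-sym (residue-≃ q)))

prefix-power : Primes L → par L ≃ η ∙ P → ∃ λ B → (η , B) ∈ L × η ∙ P ≃ (η ∙ B) ^ length L
prefix-power {[]} _ h = case ≃-size h of λ ()
prefix-power {t ∷ L} pL h with deepest t L
... | (η' , B) , p , deep with ≃-prefix-elim h (proj₁ (proj₂ (fire p)))
...   | refl , _ = B , p , ≃-trans (≃-sym h) (par-all-≃ (prefix-components-≃ pL h p deep))

nontrivial : ¬ X ∼ 𝟎 → Nontrivial X
nontrivial {X} X≁𝟎 with trivial-or-nontrivial X
... | inj₁ z = ⊥-elim (X≁𝟎 (≃⇒∼ (trivial z)))
... | inj₂ nt = nt

primes-nonempty : ∀ X → Nontrivial X → 0 < length (primes X)
primes-nonempty X nt with primes X | par-primes X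
... | [] | h = contradiction (≃-size h) λ e → <-irrefl e nt
... | _ ∷ _ | _ = s≤s z≤n

lemma2p4 : (η : Prefix) (P Q Q' : Proc) →
    (η ∙ P) ∼ (Q ∣ Q') → ¬ (Q ∼ 𝟎) → ¬ (Q' ∼ 𝟎) →
    Σ Proc (λ A → Σ ℕ (λ k → (1 < k) × ((η ∙ P) ∼ ((η ∙ A) ^ k)) × NormalForm (η ∙ A)))
lemma2p4 η P Q Q' P∼Q∣Q' Q≁𝟎 Q'≁𝟎 =
  let (B , p , P≃) = prefix-power (All.++⁺ (primes-prime Q) (primes-prime Q')) factors≃P
  in B , length factors , two-factors , ≃⇒∼ P≃ ,
     primeSubterms⇒normalForm (All.lookup (All.++⁺ (primes-primeSubterms Q) (primes-primeSubterms Q')) p)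
  where
  factors : List Prefixed
  factors = primes Q ++ primes Q'

  factors≃P : par factors ≃ η ∙ P
  factors≃P = ≃-trans (par-++ (primes Q) (primes Q'))
                (≃-trans (≃-par (par-primes Q) (par-primes Q')) (≃-sym (∼⇒≃ P∼Q∣Q')))

  two-factors : 1 < length factors
  two-factors = subst (1 <_) (sym (length-++ (primes Q)))
                      (+-mono-≤ (primes-nonempty Q (nontrivial Q≁𝟎)) (primes-nonempty Q' (nontrivial Q'≁𝟎)))
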